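{- For any finite group $G$, every perfect-code-preserving inner automorphism of $G$ is a power automorphism of $G$.
   Context: All groups and graphs are finite; $e$ denotes the identity. For $S\subseteq G$ with $e\notin S$ and $S^{ -1}=S$, the Cayley graph $\mathrm{Cay}(G,S)$ has vertex set $G$, with $x,y$ adjacent iff $yx^{ -1}\in S$. A subset $C$ of the vertex set of a graph is a perfect code if every vertex is at distance at most one from exactly one vertex of $C$. An automorphism $\sigma$ of $G$ is perfect-code-preserving if for every Cayley graph $\mathrm{Cay}(G,S)$ and every subset $C\subseteq G$ that is a perfect code in $\mathrm{Cay}(G,S)$, the image $C^\sigma$ is also a perfect code in $\mathrm{Cay}(G,S)$. A power automorphism of $G$ is an automorphism mapping every element $g$ to some power of $g$. -}

module Defs where

open import Level using (0ℓ)
open import Data.Nat using (ℕ; zero; suc)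
open import Data.Fin using (Fin)
open import Data.Fin.Properties using (any?; _≟_)
open import Data.Fin.Subset using (Subset; _∈_; _∉_)
open import Data.Fin.Subset.Properties using (_∈?_)
open import Data.Vec using (tabulate)
open import Data.Product using (Σ; ∃; _×_; _,_)
open import Data.Sum using (_⊎_)
open import Relation.Nullary.Decidable using (⌊_⌋; _×-dec_)
open import Relation.Binary.PropositionalEquality using (_≡_)
open import Algebra.Structures using (IsGroup)

-- A finite group: a group structure on the carrier Fin n
-- (every finite group is isomorphic to one of this form), with
-- propositional equality as the group equality.
record FiniteGroup : Set where
  field
    n       : ℕ
    _∙_     : Fin n → Fin n → Fin n
    e       : Fin n
    _⁻¹     : Fin n → Fin n
    isGroup : IsGroup _≡_ _∙_ e _⁻¹
  infixl 7 _∙_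
  infix  8 _⁻¹

  Elt : Set
  Elt = Fin n

  _^_ : Elt → ℕ → Elt
  g ^ zero  = e
  g ^ suc k = g ∙ (g ^ k)

module _ (G : FiniteGroup) where
  open FiniteGroup G

  IsConnectionSet : Subset n → Set
  IsConnectionSet S = (e ∉ S) × (∀ s → s ∈ S → s ⁻¹ ∈ S)

  Adj : Subset n → Elt → Elt → Set
  Adj S x y = (y ∙ x ⁻¹) ∈ S

  Close : Subset n → Elt → Elt → Set
  Close S x y = (x ≡ y) ⊎ Adj S x y

  IsPerfectCode : Subset n → Subset n → Set
  IsPerfectCode S C =
    ∀ v → (∃ λ c → c ∈ C × Close S v c)
        × (∀ c c′ → c ∈ C → Close S v c → c′ ∈ C → Close S v c′ → c ≡ c′)

  image : (Elt → Elt) → Subset n → Subset n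
  image σ C = tabulate λ y → ⌊ any? (λ c → (c ∈? C) ×-dec (σ c ≟ y)) ⌋

  IsAutomorphism : (Elt → Elt) → Set
  IsAutomorphism σ =
    (∀ x y → σ (x ∙ y) ≡ σ x ∙ σ y)
    × (∀ x y → σ x ≡ σ y → x ≡ y)
    × (∀ y → ∃ λ x → σ x ≡ y)

  conj : Elt → Elt → Elt
  conj g x = g ⁻¹ ∙ x ∙ g

  IsPerfectCodePreserving : (Elt → Elt) → Set
  IsPerfectCodePreserving σ =
    IsAutomorphism σ ×
    (∀ S C → IsConnectionSet S → IsPerfectCode S C → IsPerfectCode S (image σ C))

  IsPowerAutomorphism : (Elt → Elt) → Set
  IsPowerAutomorphism σ = IsAutomorphism σ × (∀ g → ∃ λ k → σ g ≡ g ^ k)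

-- Let σ be a perfect-code-preserving automorphism and H a subgroup. With
-- S = H ∖ {e}, the graph Cay(G,S) is the disjoint union of the complete graphs
-- on the right cosets Hv, so its perfect codes are exactly the right transversals
-- of H. If w ∉ H but σ w ∈ H, take a transversal through e and w: its image
-- contains σ e = e and σ w, two elements of the same coset H, so it is not a
-- perfect code. Hence σ⁻¹(H) ⊆ H. For σ = conjugation by g, iterating this over
-- the powers of g (and g⁻¹ being one of them) gives σ(H) ⊆ H; applied to H = ⟨x⟩
-- it says σ x is a power of x.
module Submission where

open import Defs
open import Level using (0ℓ)
open import Data.Nat using (ℕ; zero; suc; _+_; _*_; _∸_; _≤_; _<_; z≤n; _≤?_)
open import Data.Nat.Properties
  using (+-suc; +-comm; *-comm; m∸n+n≡m; ≤-antisym; n<1+n; n≢0⇒n>0; suc-injective; ≤-totalOrder)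
open import Data.Nat.DivMod using (_%_; _/_; m≡m%n+[m/n]*n; m%n<n)
open import Data.Fin using (Fin; toℕ; fromℕ<)
open import Data.Fin.Properties using (any?; all?; _≟_; pigeonhole; toℕ-fromℕ<; toℕ-injective)
open import Data.Fin.Subset using (Subset; _∈_)
open import Data.Vec using (tabulate)
open import Data.Vec.Properties using (lookup∘tabulate; []=⇒lookup; lookup⇒[]=)
open import Data.List using (filter; allFin)
open import Data.List.Extrema ≤-totalOrder using (argmin; argmin-all; f[argmin]≤f[xs])
open import Data.List.Relation.Unary.All using () renaming (lookup to All-lookup)
open import Data.List.Relation.Unary.All.Properties using (all-filter)
open import Data.List.Membership.Propositional.Properties using (∈-filter⁺; ∈-allFin)
open import Data.Bool.Properties using (T-≡)
open import Data.Product using (∃; _×_; _,_; proj₁; proj₂)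
open import Data.Sum using (inj₁; inj₂)
open import Function.Bundles using (Equivalence)
open import Function.Definitions using (Injective)
open import Relation.Nullary using (¬_; Dec; yes; no; contradiction)
open import Relation.Nullary.Decidable using (⌊_⌋; _×-dec_; ¬?; _→-dec_; toWitness; fromWitness)
open import Relation.Unary using (Pred; Decidable)
open import Relation.Binary.PropositionalEquality
open import Algebra.Structures using (IsGroup)
open import Algebra.Bundles using (Group)
import Algebra.Properties.Group as GroupProperties
import Algebra.Properties.Monoid as MonoidProperties

module _ {n : ℕ} where

  subsetOf : {Q : Pred (Fin n) 0ℓ} → Decidable Q → Subset n
  subsetOf Q? = tabulate λ y → ⌊ Q? y ⌋

  ∈-subsetOf⁺ : {Q : Pred (Fin n) 0ℓ} (Q? : Decidable Q) {y : Fin n} → Q y → y ∈ subsetOf Q?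
  ∈-subsetOf⁺ Q? {y} q =
    lookup⇒[]= y _ (trans (lookup∘tabulate _ y) (Equivalence.to T-≡ (fromWitness q)))

  ∈-subsetOf⁻ : {Q : Pred (Fin n) 0ℓ} (Q? : Decidable Q) {y : Fin n} → y ∈ subsetOf Q? → Q y
  ∈-subsetOf⁻ Q? {y} y∈ =
    toWitness (Equivalence.from T-≡ (trans (sym (lookup∘tabulate _ y)) ([]=⇒lookup y∈)))

  ∃-minimiser : {D : Pred (Fin n) 0ℓ} → Decidable D → (r : Fin n → ℕ) → ∀ {a} → D a →
                ∃ λ c → D c × (∀ c′ → D c′ → r c ≤ r c′)
  ∃-minimiser D? r {a} Da =
    argmin r a cs ,
    argmin-all r Da (all-filter D? (allFin n)) ,
    λ c′ Dc′ → All-lookup (f[argmin]≤f[xs] {f = r} a cs) (∈-filter⁺ D? (∈-allFin c′) Dc′)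
    where cs = filter D? (allFin n)

  rank : Fin n → Fin n → Fin n → ℕ
  rank a b c with c ≟ a | c ≟ b
  ... | yes _ | _     = 0
  ... | no _  | yes _ = 1
  ... | no _  | no _  = 2 + toℕ c

  rank-first : ∀ a b → rank a b a ≡ 0
  rank-first a b with a ≟ a
  ... | yes _   = refl
  ... | no a≢a  = contradiction refl a≢a

  rank-second : ∀ {a b} → ¬ b ≡ a → rank a b b ≡ 1
  rank-second {a} {b} b≢a with b ≟ a | b ≟ b
  ... | yes b≡a | _      = contradiction b≡a b≢a
  ... | no _    | yes _  = refl
  ... | no _    | no b≢b = contradiction refl b≢b

  rank-injective : ∀ {a b} → Injective _≡_ _≡_ (rank a b)
  rank-injective {a} {b} {c} {c′} eq with c ≟ a | c ≟ b | c′ ≟ a | c′ ≟ b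
  ... | yes c≡a | _       | yes c′≡a | _        = trans c≡a (sym c′≡a)
  ... | no _    | yes c≡b | no _     | yes c′≡b = trans c≡b (sym c′≡b)
  ... | no _    | no _    | no _     | no _     = toℕ-injective (suc-injective (suc-injective eq))
  ... | yes _   | _       | no _     | yes _    with () ← eq
  ... | yes _   | _       | no _     | no _     with () ← eq
  ... | no _    | yes _   | yes _    | _        with () ← eq
  ... | no _    | yes _   | no _     | no _     with () ← eq
  ... | no _    | no _    | yes _    | _        with () ← eq
  ... | no _    | no _    | no _     | yes _    with () ← eq

  rank-later : ∀ {a b c} → ¬ c ≡ a → 0 < rank a b c
  rank-later {a} {b} c≢a =
    n≢0⇒n>0 λ rank≡0 → c≢a (rank-injective (trans rank≡0 (sym (rank-first a b))))

module _ (G : FiniteGroup) where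
  open FiniteGroup G
  open IsGroup isGroup using (assoc; identityˡ; identityʳ; inverseˡ; inverseʳ)
  open ≡-Reasoning

  group : Group 0ℓ 0ℓ
  group = record { isGroup = isGroup }

  open GroupProperties group
    using (identityˡ-unique; inverseˡ-unique; inverseʳ-unique; ⁻¹-involutive; ⁻¹-anti-homo-∙; ε⁻¹≈ε; x∙y⁻¹≈ε⇒x≈y)
  open MonoidProperties (Group.monoid group) using (cancelᶜ)

  ^-homo-+ : ∀ x m k → x ^ (m + k) ≡ x ^ m ∙ x ^ k
  ^-homo-+ x zero    k = sym (identityˡ _)
  ^-homo-+ x (suc m) k = trans (cong (x ∙_) (^-homo-+ x m k)) (sym (assoc _ _ _))

  ^-*-≡e : ∀ {x m} → x ^ m ≡ e → ∀ q → x ^ (q * m) ≡ e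
  ^-*-≡e         xᵐ≡e zero    = refl
  ^-*-≡e {x} {m} xᵐ≡e (suc q) = begin
    x ^ (m + q * m)       ≡⟨ ^-homo-+ x m (q * m) ⟩
    x ^ m ∙ x ^ (q * m)   ≡⟨ cong₂ _∙_ xᵐ≡e (^-*-≡e xᵐ≡e q) ⟩
    e ∙ e                 ≡⟨ identityˡ e ⟩
    e                     ∎

  -- Two of the n + 1 powers x ^ 0, …, x ^ n coincide.
  ∃-period : ∀ x → ∃ λ d → x ^ suc d ≡ e
  ∃-period x with pigeonhole (n<1+n n) (λ (i : Fin (suc n)) → x ^ toℕ i)
  ... | i , j , i<j , xⁱ≡xʲ = d , identityˡ-unique (x ^ suc d) (x ^ toℕ i) (begin
    x ^ suc d ∙ x ^ toℕ i   ≡⟨ sym (^-homo-+ x (suc d) (toℕ i)) ⟩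
    x ^ (suc d + toℕ i)     ≡⟨ cong (x ^_) (sym (+-suc d (toℕ i))) ⟩
    x ^ (d + suc (toℕ i))   ≡⟨ cong (x ^_) (m∸n+n≡m i<j) ⟩
    x ^ toℕ j               ≡⟨ sym xⁱ≡xʲ ⟩
    x ^ toℕ i               ∎)
    where d = toℕ j ∸ suc (toℕ i)

  ^-%-period : ∀ {x d} → x ^ suc d ≡ e → ∀ k → x ^ k ≡ x ^ (k % suc d)
  ^-%-period {x} {d} xᵐ≡e k = begin
    x ^ k                             ≡⟨ cong (x ^_) (m≡m%n+[m/n]*n k m) ⟩
    x ^ (k % m + (k / m) * m)         ≡⟨ ^-homo-+ x (k % m) ((k / m) * m) ⟩
    x ^ (k % m) ∙ x ^ ((k / m) * m)   ≡⟨ cong (x ^ (k % m) ∙_) (^-*-≡e xᵐ≡e (k / m)) ⟩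
    x ^ (k % m) ∙ e                   ≡⟨ identityʳ _ ⟩
    x ^ (k % m)                       ∎
    where m = suc d

  record IsSubgroup (H : Pred Elt 0ℓ) : Set where
    field
      ε∈        : H e
      ∙-closed  : ∀ {a b} → H a → H b → H (a ∙ b)
      ⁻¹-closed : ∀ {a} → H a → H (a ⁻¹)

  powers : Elt → Pred Elt 0ℓ
  powers x y = ∃ λ k → y ≡ x ^ k

  powers-self : ∀ x → powers x x
  powers-self x = 1 , sym (identityʳ x)

  powers? : ∀ x → Decidable (powers x)
  powers? x y with ∃-period x
  ... | d , xᵐ≡e with any? (λ (i : Fin (suc d)) → y ≟ x ^ toℕ i)
  ... | yes (i , y≡xⁱ) = yes (toℕ i , y≡xⁱ)
  ... | no ¬y≡xⁱ       = no λ (k , y≡xᵏ) → ¬y≡xⁱ (fromℕ< (m%n<n k (suc d)) , (begin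
    y                                         ≡⟨ y≡xᵏ ⟩
    x ^ k                                     ≡⟨ ^-%-period xᵐ≡e k ⟩
    x ^ (k % suc d)                           ≡⟨ cong (x ^_) (sym (toℕ-fromℕ< (m%n<n k (suc d)))) ⟩
    x ^ toℕ (fromℕ< (m%n<n k (suc d)))       ∎))

  powers-isSubgroup : ∀ x → IsSubgroup (powers x)
  powers-isSubgroup x = record
    { ε∈        = 0 , refl
    ; ∙-closed  = λ (i , a≡xⁱ) (j , b≡xʲ) → i + j , trans (cong₂ _∙_ a≡xⁱ b≡xʲ) (sym (^-homo-+ x i j))
    ; ⁻¹-closed = ⁻¹-closed
    }
    where
    ⁻¹-closed : ∀ {a} → powers x a → powers x (a ⁻¹)
    ⁻¹-closed {a} (k , a≡xᵏ) with ∃-period x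
    ... | d , xᵐ≡e = d * k , (begin
      a ⁻¹           ≡⟨ cong _⁻¹ a≡xᵏ ⟩
      (x ^ k) ⁻¹     ≡⟨ sym (inverseˡ-unique (x ^ (d * k)) (x ^ k) xᵈᵏ∙xᵏ≡e) ⟩
      x ^ (d * k)    ∎)
      where
      xᵈᵏ∙xᵏ≡e : x ^ (d * k) ∙ x ^ k ≡ e
      xᵈᵏ∙xᵏ≡e = begin
        x ^ (d * k) ∙ x ^ k   ≡⟨ sym (^-homo-+ x (d * k) k) ⟩
        x ^ (d * k + k)       ≡⟨ cong (x ^_) (trans (+-comm (d * k) k) (*-comm (suc d) k)) ⟩
        x ^ (k * suc d)       ≡⟨ ^-*-≡e xᵐ≡e k ⟩
        e                     ∎

  module CosetGraph {H : Pred Elt 0ℓ} (H? : Decidable H) (H≤G : IsSubgroup H) where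
    open IsSubgroup H≤G

    SameCoset : Elt → Elt → Set
    SameCoset v c = H (c ∙ v ⁻¹)

    SameCoset? : ∀ v c → Dec (SameCoset v c)
    SameCoset? v c = H? (c ∙ v ⁻¹)

    sameCoset-refl : ∀ v → SameCoset v v
    sameCoset-refl v = subst H (sym (inverseʳ v)) ε∈

    sameCoset-sym : ∀ {v c} → SameCoset v c → SameCoset c v
    sameCoset-sym {v} {c} h = subst H (begin
      (c ∙ v ⁻¹) ⁻¹    ≡⟨ ⁻¹-anti-homo-∙ c (v ⁻¹) ⟩
      v ⁻¹ ⁻¹ ∙ c ⁻¹   ≡⟨ cong (_∙ c ⁻¹) (⁻¹-involutive v) ⟩
      v ∙ c ⁻¹         ∎) (⁻¹-closed h)

    sameCoset-trans : ∀ {a b c} → SameCoset a b → SameCoset b c → SameCoset a c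
    sameCoset-trans {a} {b} {c} h₁ h₂ =
      subst H (cancelᶜ (inverseˡ b) c (a ⁻¹)) (∙-closed h₂ h₁)

    nonIdentity : Subset n
    nonIdentity = subsetOf λ y → H? y ×-dec ¬? (y ≟ e)

    nonIdentity-isConnectionSet : IsConnectionSet G nonIdentity
    nonIdentity-isConnectionSet = e∉ , ⁻¹-∈
      where
      e∉ : ¬ e ∈ nonIdentity
      e∉ e∈ = proj₂ (∈-subsetOf⁻ _ e∈) refl

      ⁻¹-∈ : ∀ s → s ∈ nonIdentity → s ⁻¹ ∈ nonIdentity
      ⁻¹-∈ s s∈ with ∈-subsetOf⁻ _ s∈
      ... | Hs , s≢e = ∈-subsetOf⁺ _ (⁻¹-closed Hs , λ s⁻¹≡e → s≢e (begin
        s          ≡⟨ sym (⁻¹-involutive s) ⟩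
        s ⁻¹ ⁻¹    ≡⟨ cong _⁻¹ s⁻¹≡e ⟩
        e ⁻¹       ≡⟨ ε⁻¹≈ε ⟩
        e          ∎))

    close⇒sameCoset : ∀ {v c} → Close G nonIdentity v c → SameCoset v c
    close⇒sameCoset {v} (inj₁ refl) = sameCoset-refl v
    close⇒sameCoset     (inj₂ adj)  = proj₁ (∈-subsetOf⁻ _ adj)

    sameCoset⇒close : ∀ {v c} → SameCoset v c → Close G nonIdentity v c
    sameCoset⇒close {v} {c} h with (c ∙ v ⁻¹) ≟ e
    ... | yes c∙v⁻¹≡e = inj₁ (sym (x∙y⁻¹≈ε⇒x≈y c v c∙v⁻¹≡e))
    ... | no c∙v⁻¹≢e  = inj₂ (∈-subsetOf⁺ _ (h , c∙v⁻¹≢e))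

    -- The right transversal of H formed by the r-least element of each coset.
    cosetMinima : (Elt → ℕ) → Subset n
    cosetMinima r = subsetOf λ c → all? λ c′ → SameCoset? c c′ →-dec (r c ≤? r c′)

    cosetMinima-isPerfectCode : ∀ {r} → Injective _≡_ _≡_ r → IsPerfectCode G nonIdentity (cosetMinima r)
    cosetMinima-isPerfectCode {r} r-injective v = covered , unique
      where
      covered : ∃ λ c → c ∈ cosetMinima r × Close G nonIdentity v c
      covered with ∃-minimiser (SameCoset? v) r (sameCoset-refl v)
      ... | c , v~c , minimal =
        c , ∈-subsetOf⁺ _ (λ c′ c~c′ → minimal c′ (sameCoset-trans v~c c~c′)) , sameCoset⇒close v~c

      unique : ∀ c c′ → c ∈ cosetMinima r → Close G nonIdentity v c →
               c′ ∈ cosetMinima r → Close G nonIdentity v c′ → c ≡ c′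
      unique c c′ c∈ v~c c′∈ v~c′ = r-injective (≤-antisym
        (∈-subsetOf⁻ _ c∈ c′ c~c′) (∈-subsetOf⁻ _ c′∈ c (sameCoset-sym c~c′)))
        where c~c′ = sameCoset-trans (sameCoset-sym (close⇒sameCoset v~c)) (close⇒sameCoset v~c′)

  automorphism-ε : ∀ {σ} → IsAutomorphism G σ → σ e ≡ e
  automorphism-ε {σ} (homo , _) =
    identityˡ-unique (σ e) (σ e) (trans (sym (homo e e)) (cong σ (identityˡ e)))

  perfectCodePreserving⇒reflects-subgroup :
    ∀ {σ} → IsPerfectCodePreserving G σ →
    ∀ {H} → Decidable H → IsSubgroup H → ∀ w → H (σ w) → H w
  perfectCodePreserving⇒reflects-subgroup {σ} (aut , preserves) {H} H? H≤G w Hσw with H? w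
  ... | yes Hw = Hw
  ... | no ¬Hw = subst H e≡w ε∈
    where
    open IsSubgroup H≤G
    open CosetGraph H? H≤G

    w≢e : ¬ w ≡ e
    w≢e w≡e = ¬Hw (subst H (sym w≡e) ε∈)

    C : Subset n
    C = cosetMinima (rank e w)

    e∈C : e ∈ C
    e∈C = ∈-subsetOf⁺ _ λ c′ _ → subst (_≤ rank e w c′) (sym (rank-first e w)) z≤n

    w∈C : w ∈ C
    w∈C = ∈-subsetOf⁺ _ λ c′ w~c′ →
      subst (_≤ rank e w c′) (sym (rank-second w≢e)) (rank-later (≢e w~c′))
      where
      ≢e : ∀ {c′} → SameCoset w c′ → ¬ c′ ≡ e
      ≢e w~e refl = ¬Hw (subst H (trans (cong (w ∙_) ε⁻¹≈ε) (identityʳ w)) (sameCoset-sym w~e))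

    ∈-image : ∀ {c} → c ∈ C → σ c ∈ image G σ C
    ∈-image {c} c∈ = ∈-subsetOf⁺ _ (c , c∈ , refl)

    σe~σw : SameCoset (σ e) (σ w)
    σe~σw = subst H (begin
      σ w              ≡⟨ sym (identityʳ _) ⟩
      σ w ∙ e          ≡⟨ cong (σ w ∙_) (sym ε⁻¹≈ε) ⟩
      σ w ∙ e ⁻¹       ≡⟨ cong (λ t → σ w ∙ t ⁻¹) (sym (automorphism-ε aut)) ⟩
      σ w ∙ σ e ⁻¹     ∎) Hσw

    σe≡σw : σ e ≡ σ w
    σe≡σw = proj₂ (preserves nonIdentity C nonIdentity-isConnectionSet
      (cosetMinima-isPerfectCode rank-injective) (σ e))
      (σ e) (σ w) (∈-image e∈C) (inj₁ refl) (∈-image w∈C) (sameCoset⇒close σe~σw)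

    e≡w : e ≡ w
    e≡w = proj₁ (proj₂ aut) e w σe≡σw

  module _ (g : Elt) where

    conj-inverse : ∀ y → conj G g (g ∙ y ∙ g ⁻¹) ≡ y
    conj-inverse y = begin
      g ⁻¹ ∙ (g ∙ y ∙ g ⁻¹) ∙ g     ≡⟨ cong (_∙ g) (sym (assoc _ _ _)) ⟩
      g ⁻¹ ∙ (g ∙ y) ∙ g ⁻¹ ∙ g     ≡⟨ cong (λ t → t ∙ g ⁻¹ ∙ g) (sym (assoc _ _ _)) ⟩
      g ⁻¹ ∙ g ∙ y ∙ g ⁻¹ ∙ g       ≡⟨ assoc _ _ _ ⟩
      g ⁻¹ ∙ g ∙ y ∙ (g ⁻¹ ∙ g)     ≡⟨ cong₂ (λ s t → s ∙ y ∙ t) (inverseˡ g) (inverseˡ g) ⟩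
      e ∙ y ∙ e                     ≡⟨ identityʳ _ ⟩
      e ∙ y                         ≡⟨ identityˡ y ⟩
      y                             ∎

    conjugates-by-powers : ∀ {H : Pred Elt 0ℓ} → (∀ y → H y → H (g ∙ y ∙ g ⁻¹)) →
                           ∀ k {y} → H y → H (g ^ k ∙ y ∙ (g ^ k) ⁻¹)
    conjugates-by-powers {H} closed zero {y} Hy = subst H (begin
      y              ≡⟨ sym (identityˡ y) ⟩
      e ∙ y          ≡⟨ sym (identityʳ _) ⟩
      e ∙ y ∙ e      ≡⟨ cong (e ∙ y ∙_) (sym ε⁻¹≈ε) ⟩
      e ∙ y ∙ e ⁻¹   ∎) Hy
    conjugates-by-powers {H} closed (suc k) {y} Hy = subst H (begin
      g ∙ (a ∙ y ∙ a ⁻¹) ∙ g ⁻¹       ≡⟨ cong (_∙ g ⁻¹) (sym (assoc _ _ _)) ⟩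
      g ∙ (a ∙ y) ∙ a ⁻¹ ∙ g ⁻¹       ≡⟨ cong (λ t → t ∙ a ⁻¹ ∙ g ⁻¹) (sym (assoc _ _ _)) ⟩
      g ∙ a ∙ y ∙ a ⁻¹ ∙ g ⁻¹         ≡⟨ assoc _ _ _ ⟩
      g ∙ a ∙ y ∙ (a ⁻¹ ∙ g ⁻¹)       ≡⟨ cong (g ∙ a ∙ y ∙_) (sym (⁻¹-anti-homo-∙ g a)) ⟩
      g ∙ a ∙ y ∙ (g ∙ a) ⁻¹          ∎) (closed _ (conjugates-by-powers closed k Hy))
      where a = g ^ k

    perfectCodePreserving-conj⇒normalises :
      IsPerfectCodePreserving G (conj G g) →
      ∀ {H} → Decidable H → IsSubgroup H → ∀ {y} → H y → H (conj G g y)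
    perfectCodePreserving-conj⇒normalises pcp {H} H? H≤G {y} Hy with ∃-period g
    ... | d , gᵐ≡e = subst H conj-by-gᵈ (conjugates-by-powers closed d Hy)
      where
      gᵈ≡g⁻¹ : g ^ d ≡ g ⁻¹
      gᵈ≡g⁻¹ = inverseʳ-unique g (g ^ d) gᵐ≡e

      conj-by-gᵈ : g ^ d ∙ y ∙ (g ^ d) ⁻¹ ≡ conj G g y
      conj-by-gᵈ = cong₂ (λ s t → s ∙ y ∙ t) gᵈ≡g⁻¹ (trans (cong _⁻¹ gᵈ≡g⁻¹) (⁻¹-involutive g))

      closed : ∀ y → H y → H (g ∙ y ∙ g ⁻¹)
      closed y Hy = perfectCodePreserving⇒reflects-subgroup pcp H? H≤G (g ∙ y ∙ g ⁻¹)
                      (subst H (sym (conj-inverse y)) Hy)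

theorem3p5 : (G : FiniteGroup) (g : FiniteGroup.Elt G) →
    IsPerfectCodePreserving G (conj G g) → IsPowerAutomorphism G (conj G g)
theorem3p5 G g pcp = proj₁ pcp , λ x →
  perfectCodePreserving-conj⇒normalises G g pcp (powers? G x) (powers-isSubgroup G x) (powers-self G x)
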